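{- Let $\mathrm{R}$ be a countably infinite relational structure, $\mathrm{C}$ a finite relational structure and $k\in\omega$, such that $\mathrm{R}\underset{k\text{ -delta}}{\xrightarrow{\mathrm{rainbow}}}(\mathrm{R})^{\mathrm{C}}$ holds. Then for every $\mathrm{B}$ in the age of $\mathrm{R}$ there is $\mathrm{A}$ in the age of $\mathrm{R}$ such that $\mathrm{A}\underset{k\text{ -delta}}{\xrightarrow{\mathrm{rainbow}}}(\mathrm{B})^{\mathrm{C}}$. The corresponding statement holds with $k$-delta replaced by $k$-bounded throughout.
   Context: The age of $\mathrm{R}$ is the class of finite structures isomorphic to an induced substructure of $\mathrm{R}$. $\binom{\mathrm{A}}{\mathrm{C}}$ is the set of induced substructures of $\mathrm{A}$ isomorphic to $\mathrm{C}$. A $\delta$-system of copies of $\mathrm{C}$ in $\mathrm{A}$ is $\mathcal{S}\subseteq\binom{\mathrm{A}}{\mathrm{C}}$ with $X\setminus\bigcap_{Y\in\mathcal{S}}Y$ a singleton for each $X\in\mathcal{S}$. A colouring $\gamma:\binom{\mathrm{A}}{\mathrm{C}}\to\omega$ is $k$-delta if it is constant on no $\delta$-system with $k+1$ elements, and $k$-bounded if $|\gamma^{ -1}(j)|\le k$ for all $j$. $\mathrm{A}\underset{k\text{ -delta}}{\xrightarrow{\mathrm{rainbow}}}(\mathrm{B})^{\mathrm{C}}$ (resp. $k$-bdd) means: for every $k$-delta (resp. $k$-bounded) colouring $\gamma:\binom{\mathrm{A}}{\mathrm{C}}\to\omega$ there is $\mathrm{B}^*\in\binom{\mathrm{A}}{\mathrm{B}}$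 with $\gamma$ one-to-one on $\binom{\mathrm{B}^*}{\mathrm{C}}$. -}

module Defs where

open import Level using (Level; 0ℓ)
open import Data.Nat using (ℕ; suc)
open import Data.Fin using (Fin)
open import Data.Product using (Σ; ∃; _×_; _,_)
open import Data.Empty using (⊥)
open import Relation.Nullary using (¬_)
open import Relation.Binary.PropositionalEquality using (_≡_)
open import Function using (_∘_)
open import Function.Bundles using (_↔_)
open import Function.Definitions using (Injective)

record Signature : Set₁ where
  field
    Sym : Set
    ar  : Sym → ℕ
open Signature public

record Structure (L : Signature) : Set₁ where
  field
    Carrier : Set
    rel     : (s : Sym L) → (Fin (ar L s) → Carrier) → Set
open Structure public

module _ {L : Signature} where

  IsFinite : Structure L → Set
  IsFinite A = Σ ℕ λ n → Carrier A ↔ Fin n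

  IsCountablyInfinite : Structure L → Set
  IsCountablyInfinite A = Carrier A ↔ ℕ

  -- An embedding C → A: injective map preserving and reflecting all relations,
  -- i.e. an isomorphism of C onto the induced substructure on its image.
  record Emb (C A : Structure L) : Set where
    field
      fun   : Carrier C → Carrier A
      inj   : Injective _≡_ _≡_ fun
      pres  : ∀ s (t : Fin (ar L s) → Carrier C) → rel C s t → rel A s (fun ∘ t)
      refl' : ∀ s (t : Fin (ar L s) → Carrier C) → rel A s (fun ∘ t) → rel C s t
  open Emb public

  _∈Im_ : {C A : Structure L} → Carrier A → Emb C A → Set
  a ∈Im f = ∃ λ c → fun f c ≡ a

  SameCopy : {C A : Structure L} → Emb C A → Emb C A → Set
  SameCopy {A = A} f g = ∀ (a : Carrier A) → (a ∈Im f → a ∈Im g) × (a ∈Im g → a ∈Im f)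

  _⊆Im_ : {C B A : Structure L} → Emb C A → Emb B A → Set
  _⊆Im_ {A = A} f h = ∀ (a : Carrier A) → a ∈Im f → a ∈Im h

  InAge : Structure L → Structure L → Set
  InAge R B = IsFinite B × Emb B R

  -- A colouring γ : (A choose C) → ω, presented as a function on embeddings
  -- which only depends on the copy (image) of the embedding.
  record Colouring (A C : Structure L) : Set where
    field
      col       : Emb C A → ℕ
      well-def  : ∀ f g → SameCopy f g → col f ≡ col g
  open Colouring public

  Distinct : {C A : Structure L} (k : ℕ) → (Fin (suc k) → Emb C A) → Set
  Distinct k X = ∀ i j → SameCopy (X i) (X j) → i ≡ j

  -- δ-system: for every member X, X ∖ ⋂ S is a singleton.
  InKernel : {C A : Structure L} (k : ℕ) → (Fin (suc k) → Emb C A) → Carrier A → Set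
  InKernel k X a = ∀ j → a ∈Im X j

  IsDeltaSystem : {C A : Structure L} (k : ℕ) → (Fin (suc k) → Emb C A) → Set
  IsDeltaSystem {A = A} k X =
    ∀ i → Σ (Carrier A) λ a →
      (a ∈Im X i × ¬ InKernel k X a) ×
      (∀ b → b ∈Im X i → ¬ InKernel k X b → b ≡ a)

  ConstantOn : {C A : Structure L} (k : ℕ) → Colouring A C → (Fin (suc k) → Emb C A) → Set
  ConstantOn k γ X = ∀ i j → col γ (X i) ≡ col γ (X j)

  KDelta : {C A : Structure L} → ℕ → Colouring A C → Set
  KDelta k γ = ∀ X → Distinct k X → IsDeltaSystem k X → ¬ ConstantOn k γ X

  -- k-bounded: every colour class has at most k elements,
  -- i.e. no k+1 distinct copies share a colour.
  KBounded : {C A : Structure L} → ℕ → Colouring A C → Set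
  KBounded k γ = ∀ X → Distinct k X → ¬ ConstantOn k γ X

  InjectiveOnCopiesIn : {C B A : Structure L} → Colouring A C → Emb B A → Set
  InjectiveOnCopiesIn γ h =
    ∀ f g → f ⊆Im h → g ⊆Im h → col γ f ≡ col γ g → SameCopy f g

  RainbowDelta : ℕ → Structure L → Structure L → Structure L → Set
  RainbowDelta k A B C =
    (γ : Colouring A C) → KDelta k γ → Σ (Emb B A) λ h → InjectiveOnCopiesIn γ h

  RainbowBdd : ℕ → Structure L → Structure L → Structure L → Set
  RainbowBdd k A B C =
    (γ : Colouring A C) → KBounded k γ → Σ (Emb B A) λ h → InjectiveOnCopiesIn γ h

-- Let Seg n be the substructure of R induced on its first n points.  If no
-- Seg n works, pick bad colourings γ n of every Seg n.  Pairs of copies of C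
-- in R are coded by naturals (Cantor pairing of their index tuples).  By
-- compactness of 2^ℕ the questions "is pair j coloured alike by γ n?" have
-- limit answers, agreed with by arbitrarily late γ n on any finite set of
-- questions.  Numbering the classes of this limit equivalence colours R;
-- each finite configuration of it is reproduced by some γ n, so it is again
-- k-delta (resp. k-bounded), and a rainbow copy of R for it yields a rainbow
-- copy of B for some γ n: a contradiction.
module Submission where

open import Defs
open import Level using (Level; 0ℓ)
open import Data.Nat using (ℕ)
open import Data.Product using (Σ; _×_)
open import Axiom.ExcludedMiddle using (ExcludedMiddle)

open import Axiom.DoubleNegationElimination using (em⇒dne)
open import Data.Nat
open import Data.Nat.Properties
open import Data.Nat.Induction using (<-rec)
open import Data.Fin using (Fin; zero; suc; toℕ; fromℕ<)
open import Data.Fin.Properties using (toℕ-fromℕ<; toℕ<n; toℕ-injective)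
open import Data.Vec.Functional using ([]; _∷_)
open import Data.Bool using (Bool; true; false)
open import Data.Unit using (⊤; tt)
open import Data.Empty using (⊥-elim)
open import Data.Product
open import Data.Product.Properties using (,-injectiveˡ; ,-injectiveʳ)
open import Data.Sum using (inj₁; inj₂)
open import Function using (_∘_)
open import Function.Bundles using (_↔_; Inverse; mk↔ₛ′; _⇔_; mk⇔; Equivalence)
open import Function.Properties.Equivalence using () renaming (trans to ⇔-trans)
open import Relation.Nullary
open import Relation.Unary using (Decidable)
open import Relation.Binary.Definitions using (tri<; tri≈; tri>)
open import Relation.Binary.Structures using (IsEquivalence)
open import Relation.Binary.PropositionalEquality
open Equivalence using (to; from)
open ≡-Reasoning

-- Cantor's pairing: the pair (a , b) sits at position triangle (a + b) + a
-- of the enumeration of ℕ × ℕ along the anti-diagonals a + b = s.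
triangle : ℕ → ℕ
triangle zero    = 0
triangle (suc s) = triangle s + suc s

pair : ℕ → ℕ → ℕ
pair a b = triangle (a + b) + a

next : ℕ × ℕ → ℕ × ℕ
next (a , zero)  = 0 , suc a
next (a , suc b) = suc a , b

unpair : ℕ → ℕ × ℕ
unpair zero    = 0 , 0
unpair (suc j) = next (unpair j)

pair-along : ∀ a b → pair (suc a) b ≡ suc (pair a (suc b))
pair-along a b = begin
  triangle (suc a + b) + suc a   ≡⟨ cong (λ s → triangle s + suc a) (sym (+-suc a b)) ⟩
  triangle (a + suc b) + suc a   ≡⟨ +-suc _ a ⟩
  suc (triangle (a + suc b) + a) ∎

pair-newDiagonal : ∀ b → pair 0 (suc b) ≡ suc (pair b 0)
pair-newDiagonal b = begin
  triangle b + suc b + 0   ≡⟨ +-identityʳ _ ⟩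
  triangle b + suc b       ≡⟨ +-suc _ b ⟩
  suc (triangle b + b)     ≡⟨ cong (λ s → suc (triangle s + b)) (sym (+-identityʳ b)) ⟩
  suc (triangle (b + 0) + b) ∎

unpair-pair : ∀ a b → unpair (pair a b) ≡ (a , b)
unpair-pair a b = onDiagonal (a + b) a b refl
  where
  onDiagonal : ∀ s a b → a + b ≡ s → unpair (pair a b) ≡ (a , b)
  onDiagonal s (suc a) b eq = begin
    unpair (pair (suc a) b)        ≡⟨ cong unpair (pair-along a b) ⟩
    next (unpair (pair a (suc b))) ≡⟨ cong next (onDiagonal s a (suc b) (trans (+-suc a b) eq)) ⟩
    (suc a , b)                    ∎
  onDiagonal s zero zero eq = refl
  onDiagonal (suc s) zero (suc b) eq = begin
    unpair (pair 0 (suc b))  ≡⟨ cong unpair (pair-newDiagonal b) ⟩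
    next (unpair (pair b 0)) ≡⟨ cong next (onDiagonal s b 0 (trans (+-identityʳ b) (suc-injective eq))) ⟩
    (0 , suc b)              ∎

pair-injective : ∀ {a b a' b'} → pair a b ≡ pair a' b' → a ≡ a' × b ≡ b'
pair-injective {a} {b} {a'} {b'} eq = ,-injectiveˡ same , ,-injectiveʳ same
  where
  same : (a , b) ≡ (a' , b')
  same = trans (sym (unpair-pair a b)) (trans (cong unpair eq) (unpair-pair a' b'))

triangle-mono : ∀ {s t} → s ≤ t → triangle s ≤ triangle t
triangle-mono {zero}  _         = z≤n
triangle-mono {suc s} (s≤s s≤t) = +-mono-≤ (triangle-mono s≤t) (s≤s s≤t)

pair-mono : ∀ {a a' b b'} → a ≤ a' → b ≤ b' → pair a b ≤ pair a' b'
pair-mono a≤a' b≤b' = +-mono-≤ (triangle-mono (+-mono-≤ a≤a' b≤b')) a≤a'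

encode : ∀ {c} → (Fin c → ℕ) → ℕ
encode {zero}  u = 0
encode {suc c} u = pair (u zero) (encode (u ∘ suc))

encode-injective : ∀ {c} (u v : Fin c → ℕ) → encode u ≡ encode v → ∀ i → u i ≡ v i
encode-injective {suc c} u v eq zero    = proj₁ (pair-injective {u zero} {_} {v zero} eq)
encode-injective {suc c} u v eq (suc i) =
  encode-injective (u ∘ suc) (v ∘ suc) (proj₂ (pair-injective {u zero} {_} {v zero} eq)) i

encode-mono : ∀ {c} (u v : Fin c → ℕ) → (∀ i → u i ≤ v i) → encode u ≤ encode v
encode-mono {zero}  u v u≤v = z≤n
encode-mono {suc c} u v u≤v =
  pair-mono {u zero} {v zero} (u≤v zero) (encode-mono (u ∘ suc) (v ∘ suc) (u≤v ∘ suc))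

finiteBound : ∀ {m} (f : Fin m → ℕ) → ∃ λ M → ∀ i → f i < M
finiteBound {zero}  f = 0 , λ ()
finiteBound {suc m} f with finiteBound (f ∘ suc)
... | M , bound = suc (f zero) ⊔ M , λ where
  zero    → m≤m⊔n (suc (f zero)) M
  (suc i) → <-≤-trans (bound i) (m≤n⊔m (suc (f zero)) M)

Least : (ℕ → Set) → ℕ → Set
Least P m = P m × (∀ {i} → i < m → ¬ P i)

least : {P : ℕ → Set} → Decidable P → ∀ j → P j → ∃ (Least P)
least {P} P? = <-rec (λ j → P j → ∃ (Least P)) search
  where
  search : ∀ j → (∀ {i} → i < j → P i → ∃ (Least P)) → P j → ∃ (Least P)
  search j smaller pj with anyUpTo? P? j
  ... | yes (i , i<j , pi) = smaller i<j pi
  ... | no none            = j , pj , λ i<j pi → none (_ , i<j , pi)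

least-unique : {P P' : ℕ → Set} → (∀ j → P j ⇔ P' j) →
               ∀ {m m'} → Least P m → Least P' m' → m ≡ m'
least-unique P⇔P' {m} {m'} (pm , minm) (pm' , minm') with <-cmp m m'
... | tri< m<m' _ _ = ⊥-elim (minm' m<m' (to (P⇔P' m) pm))
... | tri≈ _ m≡m' _ = m≡m'
... | tri> _ _ m>m' = ⊥-elim (minm m>m' (from (P⇔P' m') pm'))

does⇔ : {P : Set} (d : Dec P) → does d ≡ true ⇔ P
does⇔ (yes p) = mk⇔ (λ _ → p) (λ _ → refl)
does⇔ (no ¬p) = mk⇔ (λ ()) (⊥-elim ∘ ¬p)

module Classical (em : ExcludedMiddle 0ℓ) where

  ¬∀⇒∃¬ : {A : Set} {P : A → Set} → ¬ (∀ x → P x) → ∃ λ x → ¬ P x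
  ¬∀⇒∃¬ {P = P} ¬∀ with em {∃ λ x → ¬ P x}
  ... | yes found = found
  ... | no ¬found = ⊥-elim (¬∀ λ x → em⇒dne em λ ¬px → ¬found (x , ¬px))

  counterexample : {A : Set} {P Q : A → Set} → ¬ (∀ x → P x → Q x) → ∃ λ x → P x × ¬ Q x
  counterexample ¬∀ with ¬∀⇒∃¬ ¬∀
  ... | x , ¬imp = x , em⇒dne em (λ ¬px → ¬imp (⊥-elim ∘ ¬px)) , (λ qx → ¬imp λ _ → qx)

  Unbounded : (ℕ → Set) → Set
  Unbounded P = ∀ a → ∃ λ n → a ≤ n × P n

  unboundedPart : {P : ℕ → Set} → Unbounded P → (q : ℕ → Bool) →
                  Σ Bool λ v → Unbounded (λ n → P n × q n ≡ v)
  unboundedPart {P} unb q with em {Unbounded (λ n → P n × q n ≡ true)}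
  ... | yes unbTrue = true , unbTrue
  ... | no ¬unbTrue with ¬∀⇒∃¬ ¬unbTrue
  ...   | a₀ , noneAbove = false , unbFalse
    where
    unbFalse : Unbounded (λ n → P n × q n ≡ false)
    unbFalse a with unb (a ⊔ a₀)
    ... | n , le , pn with q n in qn
    ...   | false = n , ≤-trans (m≤m⊔n a a₀) le , pn , qn
    ...   | true  = ⊥-elim (noneAbove (n , ≤-trans (m≤n⊔m a a₀) le , pn , qn))

  InfiniteSet : Set₁
  InfiniteSet = Σ (ℕ → Set) Unbounded

  -- Successive refinement: stage j is an unbounded set of indices n at which
  -- the questions i < j have the answers  answer i;  stage (j+1) keeps those
  -- indices of stage j at which question j has an answer that occurs
  -- unboundedly often there.
  module Refinement (Q : ℕ → ℕ → Bool) where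

    refine : InfiniteSet → ℕ → Σ Bool λ v → InfiniteSet
    refine (P , unb) j with unboundedPart unb (Q j)
    ... | v , unb' = v , (λ n → P n × Q j n ≡ v) , unb'

    stage : ℕ → InfiniteSet
    stage zero    = (λ _ → ⊤) , λ a → a , ≤-refl , tt
    stage (suc j) = proj₂ (refine (stage j) j)

    answer : ℕ → Bool
    answer j = proj₁ (refine (stage j) j)

    stage-agrees : ∀ J n → proj₁ (stage J) n → ∀ {j} → j < J → Q j n ≡ answer j
    stage-agrees (suc J) n (inJ , qJ) {j} j<1+J with m≤n⇒m<n∨m≡n (≤-pred j<1+J)
    ... | inj₁ j<J  = stage-agrees J n inJ j<J
    ... | inj₂ refl = qJ

  -- Compactness of Cantor space: for any sequence n ↦ (j ↦ Q j n) of points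
  -- of 2^ℕ there is a point b every finite prefix of which is shared by
  -- arbitrarily late terms of the sequence.
  limitPoint : (Q : ℕ → ℕ → Bool) → Σ (ℕ → Bool) λ b →
               ∀ J a → ∃ λ n → a ≤ n × (∀ {j} → j < J → Q j n ≡ b j)
  limitPoint Q = answer , λ J a →
    let (n , a≤n , inJ) = proj₂ (stage J) a in n , a≤n , stage-agrees J n inJ
    where open Refinement Q

  -- An equivalence relation on a set with a map into ℕ that is injective
  -- up to the relation is classified by a map into ℕ: send x to the least
  -- code of an element related to x.
  classify : {S : Set} (E : S → S → Set) → IsEquivalence E → (enc : S → ℕ) →
             (∀ x y → enc x ≡ enc y → E x y) →
             Σ (S → ℕ) λ cl → ∀ x y → (cl x ≡ cl y) ⇔ E x y
  classify {S} E isEq enc enc-reflects = cl , λ x y → mk⇔ (sound x y) (complete x y)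
    where
    open IsEquivalence isEq renaming (refl to E-refl; sym to E-sym; trans to E-trans)
    Rep : S → ℕ → Set
    Rep x j = ∃ λ y → enc y ≡ j × E y x

    leastRep : ∀ x → ∃ (Least (Rep x))
    leastRep x = least (λ j → em) (enc x) (x , refl , E-refl)

    cl : S → ℕ
    cl x = proj₁ (leastRep x)

    complete : ∀ x y → E x y → cl x ≡ cl y
    complete x y xEy = least-unique
      (λ j → mk⇔ (λ (z , ez , zEx) → z , ez , E-trans zEx xEy)
                 (λ (z , ez , zEy) → z , ez , E-trans zEy (E-sym xEy)))
      (proj₂ (leastRep x)) (proj₂ (leastRep y))

    sound : ∀ x y → cl x ≡ cl y → E x y
    sound x y eq with proj₁ (proj₂ (leastRep x)) | proj₁ (proj₂ (leastRep y))
    ... | z , ez , zEx | w , ew , wEy =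
      E-trans (E-sym zEx) (E-trans (enc-reflects z w (trans ez (trans eq (sym ew)))) wEy)

module _ {L : Signature} where

  _∘ₑ_ : {D A A' : Structure L} → Emb A A' → Emb D A → Emb D A'
  h ∘ₑ e = record
    { fun   = fun h ∘ fun e
    ; inj   = inj e ∘ inj h
    ; pres  = λ s t r → pres h s (fun e ∘ t) (pres e s t r)
    ; refl' = λ s t r → refl' e s t (refl' h s (fun e ∘ t) r)
    }

  pointwise⇒sameCopy : {D A : Structure L} {X Y : Emb D A} →
                       (∀ x → fun X x ≡ fun Y x) → SameCopy X Y
  pointwise⇒sameCopy same a =
    (λ (x , eq) → x , trans (sym (same x)) eq) , (λ (x , eq) → x , trans (same x) eq)

  ⊆-∘ₑ : {C D A A' : Structure L} (X : Emb C A') (h : Emb A A') (e : Emb D A) →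
         X ⊆Im (h ∘ₑ e) → X ⊆Im h
  ⊆-∘ₑ X h e X⊆ a a∈X with X⊆ a a∈X
  ... | d , eq = fun e d , eq

module InitialSegments {L : Signature} (R : Structure L) (enum : Carrier R ↔ ℕ) where

  index : Carrier R → ℕ
  index = Inverse.to enum

  index-injective : ∀ {x y} → index x ≡ index y → x ≡ y
  index-injective {x} {y} eq = begin
    x                             ≡⟨ sym (Inverse.strictlyInverseʳ enum x) ⟩
    Inverse.from enum (index x)   ≡⟨ cong (Inverse.from enum) eq ⟩
    Inverse.from enum (index y)   ≡⟨ Inverse.strictlyInverseʳ enum y ⟩
    y                             ∎

  Seg : ℕ → Structure L
  Seg n = record
    { Carrier = Σ (Carrier R) λ x → index x < n
    ; rel     = λ s t → rel R s (proj₁ ∘ t)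
    }

  seg-≡ : ∀ {n} {x y : Carrier (Seg n)} → proj₁ x ≡ proj₁ y → x ≡ y
  seg-≡ {x = x , p} {y = .x , q} refl = cong (x ,_) (<-irrelevant p q)

  seg-finite : ∀ n → IsFinite (Seg n)
  seg-finite n = n , mk↔ₛ′ toFin fromFin toFin-fromFin fromFin-toFin
    where
    toFin : Carrier (Seg n) → Fin n
    toFin (x , p) = fromℕ< p
    fromFin : Fin n → Carrier (Seg n)
    fromFin i = Inverse.from enum (toℕ i) ,
                subst (_< n) (sym (Inverse.strictlyInverseˡ enum (toℕ i))) (toℕ<n i)
    toFin-fromFin : ∀ i → toFin (fromFin i) ≡ i
    toFin-fromFin i = toℕ-injective (trans (toℕ-fromℕ< _) (Inverse.strictlyInverseˡ enum (toℕ i)))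
    fromFin-toFin : ∀ x → fromFin (toFin x) ≡ x
    fromFin-toFin (x , p) =
      seg-≡ (trans (cong (Inverse.from enum) (toℕ-fromℕ< p)) (Inverse.strictlyInverseʳ enum x))

  inclusion : ∀ n → Emb (Seg n) R
  inclusion n = record { fun = proj₁ ; inj = seg-≡ ; pres = λ s t r → r ; refl' = λ s t r → r }

  seg-inAge : ∀ n → InAge R (Seg n)
  seg-inAge n = seg-finite n , inclusion n

  Below : {D : Structure L} → ℕ → Emb D R → Set
  Below n X = ∀ x → index (fun X x) < n

  below-mono : ∀ {D M n} {X : Emb D R} → M ≤ n → Below M X → Below n X
  below-mono M≤n below x = <-≤-trans (below x) M≤n

  below-∈ : ∀ {D n} (X : Emb D R) → Below n X → ∀ {a} → a ∈Im X → index a < n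
  below-∈ X below (x , refl) = below x

  below-⊆ : ∀ {C D n} (X : Emb C R) (Y : Emb D R) → X ⊆Im Y → Below n Y → Below n X
  below-⊆ X Y X⊆Y below x = below-∈ Y below (X⊆Y (fun X x) (x , refl))

  finite-below : ∀ {D} → IsFinite D → (X : Emb D R) → ∃ λ M → Below M X
  finite-below (d , iso) X with finiteBound (λ i → index (fun X (Inverse.from iso i)))
  ... | M , bound = M , λ x →
    subst (λ y → index (fun X y) < M) (Inverse.strictlyInverseʳ iso x) (bound (Inverse.to iso x))

  commonBound : ∀ {D m} → IsFinite D → (X : Fin m → Emb D R) → ∃ λ M → ∀ i → Below M (X i)
  commonBound finite X with finiteBound (λ i → proj₁ (finite-below finite (X i)))
  ... | M , bound = M , λ i → below-mono {X = X i} (<⇒≤ (bound i)) (proj₂ (finite-below finite (X i)))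

  restrict : ∀ {D n} (X : Emb D R) → Below n X → Emb D (Seg n)
  restrict X below = record
    { fun = λ x → fun X x , below x ; inj = inj X ∘ cong proj₁ ; pres = pres X ; refl' = refl' X }

  unrestrict : ∀ {D n} → Emb D (Seg n) → Emb D R
  unrestrict {n = n} e = inclusion n ∘ₑ e

  unrestrict-below : ∀ {D n} (e : Emb D (Seg n)) → Below n (unrestrict e)
  unrestrict-below e x = proj₂ (fun e x)

  ∈-restrict : ∀ {D n} (X : Emb D R) (p : Below n X) (a : Carrier (Seg n)) →
               a ∈Im restrict X p ⇔ proj₁ a ∈Im X
  ∈-restrict X p a = mk⇔ (λ (x , eq) → x , cong proj₁ eq) (λ (x , eq) → x , seg-≡ eq)

  ∈-unrestrict : ∀ {D n} (e : Emb D (Seg n)) (a : Carrier (Seg n)) →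
                 a ∈Im e ⇔ proj₁ a ∈Im unrestrict e
  ∈-unrestrict e a = mk⇔ (λ (x , eq) → x , cong proj₁ eq) (λ (x , eq) → x , seg-≡ eq)

  restrict-sameCopy : ∀ {D n} (X Y : Emb D R) (p : Below n X) (q : Below n Y) →
                      SameCopy X Y → SameCopy (restrict X p) (restrict Y q)
  restrict-sameCopy X Y p q same a =
    from (∈-restrict Y q a) ∘ proj₁ (same (proj₁ a)) ∘ to (∈-restrict X p a) ,
    from (∈-restrict X p a) ∘ proj₂ (same (proj₁ a)) ∘ to (∈-restrict Y q a)

  restrict-reflects : ∀ {D n} (X Y : Emb D R) (p : Below n X) (q : Below n Y) →
                      SameCopy (restrict X p) (restrict Y q) → SameCopy X Y
  restrict-reflects X Y p q same a =
    (λ a∈X → let a' = a , below-∈ X p a∈X in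
       to (∈-restrict Y q a') (proj₁ (same a') (from (∈-restrict X p a') a∈X))) ,
    (λ a∈Y → let a' = a , below-∈ Y q a∈Y in
       to (∈-restrict X p a') (proj₂ (same a') (from (∈-restrict Y q a') a∈Y)))

  unrestrict-reflects : ∀ {D n} (e e' : Emb D (Seg n)) →
                        SameCopy (unrestrict e) (unrestrict e') → SameCopy e e'
  unrestrict-reflects e e' same a =
    from (∈-unrestrict e' a) ∘ proj₁ (same (proj₁ a)) ∘ to (∈-unrestrict e a) ,
    from (∈-unrestrict e a) ∘ proj₂ (same (proj₁ a)) ∘ to (∈-unrestrict e' a)

  restrict-unrestrict : ∀ {D n} (e : Emb D (Seg n)) (p : Below n (unrestrict e)) →
                        SameCopy (restrict (unrestrict e) p) e
  restrict-unrestrict e p = pointwise⇒sameCopy {X = restrict (unrestrict e) p} {Y = e} λ x → seg-≡ refl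

  unrestrict-⊆ : ∀ {C D n} (e : Emb C (Seg n)) (X : Emb D R) (p : Below n X) →
                 e ⊆Im restrict X p → unrestrict e ⊆Im X
  unrestrict-⊆ e X p e⊆ _ (x , refl) = to (∈-restrict X p (fun e x)) (e⊆ (fun e x) (x , refl))

  module _ {C : Structure L} {k n : ℕ} (X : Fin (suc k) → Emb C R) (below : ∀ i → Below n (X i)) where

    restrictAll : Fin (suc k) → Emb C (Seg n)
    restrictAll i = restrict (X i) (below i)

    restrict-distinct : Distinct k X → Distinct k restrictAll
    restrict-distinct distinct i j same =
      distinct i j (restrict-reflects (X i) (X j) (below i) (below j) same)

    kernel-restrict : ∀ a → InKernel k restrictAll a ⇔ InKernel k X (proj₁ a)
    kernel-restrict a = mk⇔ (λ inK j → to (∈-restrict (X j) (below j) a) (inK j))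
                            (λ inK j → from (∈-restrict (X j) (below j) a) (inK j))

    restrict-delta : IsDeltaSystem k X → IsDeltaSystem k restrictAll
    restrict-delta delta i with delta i
    ... | a , (a∈Xi , a∉K) , unique =
      a' , (from (∈-restrict (X i) (below i) a') a∈Xi , a∉K ∘ to (kernel-restrict a')) , unique'
      where
      a' : Carrier (Seg n)
      a' = a , below-∈ (X i) (below i) a∈Xi
      unique' : ∀ b → b ∈Im restrictAll i → ¬ InKernel k restrictAll b → b ≡ a'
      unique' b b∈Xi b∉K = seg-≡ (unique (proj₁ b) (to (∈-restrict (X i) (below i) b) b∈Xi)
                                          (b∉K ∘ from (kernel-restrict b)))

module LimitColouring (em : ExcludedMiddle 0ℓ) {L : Signature} (R : Structure L)
                      (enum : Carrier R ↔ ℕ) (C : Structure L) (c : ℕ) (isoC : Carrier C ↔ Fin c) where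
  open Classical em
  open InitialSegments R enum

  finiteC : IsFinite C
  finiteC = c , isoC

  code : Emb C R → ℕ
  code X = encode (λ i → index (fun X (Inverse.from isoC i)))

  code-reflects : ∀ X Y → code X ≡ code Y → SameCopy X Y
  code-reflects X Y eq = pointwise⇒sameCopy {X = X} {Y = Y} λ x →
    subst (λ z → fun X z ≡ fun Y z) (Inverse.strictlyInverseʳ isoC x)
          (index-injective (encode-injective _ _ eq (Inverse.to isoC x)))

  codeBound : ℕ → ℕ
  codeBound M = encode {c} (λ _ → M)

  code-below : ∀ {M} X → Below M X → code X ≤ codeBound M
  code-below X below = encode-mono _ _ (λ i → <⇒≤ (below (Inverse.from isoC i)))

  pairCode : Emb C R → Emb C R → ℕ
  pairCode X Y = pair (code X) (code Y)

  module _ (γ : ∀ n → Colouring (Seg n) C) where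

    colourAt : ∀ n (X : Emb C R) → Below n X → ℕ
    colourAt n X p = col (γ n) (restrict X p)

    colourAt-sameCopy : ∀ {n} X Y (p : Below n X) (q : Below n Y) →
                        SameCopy X Y → colourAt n X p ≡ colourAt n Y q
    colourAt-sameCopy {n} X Y p q same = well-def (γ n) _ _ (restrict-sameCopy X Y p q same)

    AlikeAt : ℕ → ℕ → Set
    AlikeAt j n = ∃₂ λ X Y → pairCode X Y ≡ j ×
                  Σ (Below n X) λ p → Σ (Below n Y) λ q → colourAt n X p ≡ colourAt n Y q

    alikeAt⇔ : ∀ {n} X Y (p : Below n X) (q : Below n Y) →
               AlikeAt (pairCode X Y) n ⇔ colourAt n X p ≡ colourAt n Y q
    alikeAt⇔ {n} X Y p q = mk⇔ sound (λ eq → X , Y , refl , p , q , eq)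
      where
      sound : AlikeAt (pairCode X Y) n → colourAt n X p ≡ colourAt n Y q
      sound (X' , Y' , codes , p' , q' , alike) with pair-injective {code X'} {code Y'} codes
      ... | sameX , sameY = begin
        colourAt n X p    ≡⟨ colourAt-sameCopy X X' p p' (code-reflects X X' (sym sameX)) ⟩
        colourAt n X' p'  ≡⟨ alike ⟩
        colourAt n Y' q'  ≡⟨ colourAt-sameCopy Y' Y q' q (code-reflects Y' Y sameY) ⟩
        colourAt n Y q    ∎

    -- It is
    -- opaque: only its stated property is used, and unfolding the classical
    -- construction would make type checking blow up.
    opaque
      limit : Σ (ℕ → Bool) λ b → ∀ J a → ∃ λ n → a ≤ n × (∀ {j} → j < J → does (em {AlikeAt j n}) ≡ b j)
      limit = limitPoint λ j n → does (em {AlikeAt j n})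

    LimitAlike : Emb C R → Emb C R → Set
    LimitAlike X Y = proj₁ limit (pairCode X Y) ≡ true

    -- Copies inside a fixed Seg M are alike in the limit iff they are alike
    -- at some common later stage n; this is the only link between the limit
    -- and the γ n.
    limitAlike-approx : ∀ M → ∃ λ n → M ≤ n ×
      (∀ X Y → Below M X → Below M Y → (p : Below n X) (q : Below n Y) →
         LimitAlike X Y ⇔ colourAt n X p ≡ colourAt n Y q)
    limitAlike-approx M with proj₂ limit (suc (pair (codeBound M) (codeBound M))) M
    ... | n , M≤n , agree = n , M≤n , λ X Y bX bY p q →
      let j<J = s≤s (pair-mono (code-below X bX) (code-below Y bY)) in
      ⇔-trans (subst (λ b → b ≡ true ⇔ AlikeAt (pairCode X Y) n) (agree j<J) (does⇔ em))
              (alikeAt⇔ X Y p q)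

    atStage : ∀ {m} (X : Fin m → Emb C R) → ∃ λ n → Σ (∀ i → Below n (X i)) λ below →
              ∀ i j → LimitAlike (X i) (X j) ⇔ colourAt n (X i) (below i) ≡ colourAt n (X j) (below j)
    atStage X with commonBound finiteC X
    ... | M , belowM with limitAlike-approx M
    ...   | n , M≤n , approx = n , below , λ i j → approx (X i) (X j) (belowM i) (belowM j) (below i) (below j)
      where
      below : ∀ i → Below n (X i)
      below i = below-mono {X = X i} M≤n (belowM i)

    limitAlike-isEquivalence : IsEquivalence LimitAlike
    limitAlike-isEquivalence = record
      { refl  = λ {X} → alikeRefl X
      ; sym   = λ {X} {Y} → alikeSym X Y
      ; trans = λ {X} {Y} {Z} → alikeTrans X Y Z
      }
      where
      alikeRefl : ∀ X → LimitAlike X X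
      alikeRefl X with atStage (X ∷ [])
      ... | _ , _ , agree = from (agree zero zero) refl
      alikeSym : ∀ X Y → LimitAlike X Y → LimitAlike Y X
      alikeSym X Y XY with atStage (X ∷ Y ∷ [])
      ... | _ , _ , agree = from (agree (suc zero) zero) (sym (to (agree zero (suc zero)) XY))
      alikeTrans : ∀ X Y Z → LimitAlike X Y → LimitAlike Y Z → LimitAlike X Z
      alikeTrans X Y Z XY YZ with atStage (X ∷ Y ∷ Z ∷ [])
      ... | _ , _ , agree = from (agree zero (suc (suc zero)))
                              (trans (to (agree zero (suc zero)) XY) (to (agree (suc zero) (suc (suc zero))) YZ))

    limitAlike-sameCopy : ∀ X Y → SameCopy X Y → LimitAlike X Y
    limitAlike-sameCopy X Y same with atStage (X ∷ Y ∷ [])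
    ... | _ , below , agree =
      from (agree zero (suc zero)) (colourAt-sameCopy X Y (below zero) (below (suc zero)) same)

    -- The limit colouring: one colour per limit-alike class (opaque for the
    -- same reason as limit).
    opaque
      classes : Σ (Emb C R → ℕ) λ cl → ∀ X Y → (cl X ≡ cl Y) ⇔ LimitAlike X Y
      classes = classify LimitAlike limitAlike-isEquivalence code
                         (λ X Y eq → limitAlike-sameCopy X Y (code-reflects X Y eq))

    limitColouring : Colouring R C
    limitColouring = record
      { col      = proj₁ classes
      ; well-def = λ X Y same → from (proj₂ classes X Y) (limitAlike-sameCopy X Y same) }

    constantAtStage : ∀ {k} (X : Fin (suc k) → Emb C R) → ConstantOn k limitColouring X →
                      ∃ λ n → Σ (∀ i → Below n (X i)) λ below → ConstantOn k (γ n) (restrictAll X below)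
    constantAtStage X constant with atStage X
    ... | n , below , agree =
      n , below , λ i j → to (agree i j) (to (proj₂ classes (X i) (X j)) (constant i j))

    limit-kBounded : ∀ {k} → (∀ n → KBounded k (γ n)) → KBounded k limitColouring
    limit-kBounded bounded X distinct constant with constantAtStage X constant
    ... | n , below , constant' = bounded n (restrictAll {n = n} X below) (restrict-distinct {n = n} X below distinct) constant'

    limit-kDelta : ∀ {k} → (∀ n → KDelta k (γ n)) → KDelta k limitColouring
    limit-kDelta kDelta X distinct delta constant with constantAtStage X constant
    ... | n , below , constant' =
      kDelta n (restrictAll {n = n} X below) (restrict-distinct {n = n} X below distinct)
             (restrict-delta {n = n} X below delta) constant'

    limit-rainbow : ∀ {B} → IsFinite B → (eB : Emb B R) (h : Emb R R) →
                    InjectiveOnCopiesIn limitColouring h → ∃ λ n → Σ (Emb B (Seg n)) (InjectiveOnCopiesIn (γ n))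
    limit-rainbow {B} finiteB eB h rainbow with finite-below finiteB (h ∘ₑ eB)
    ... | M , belowM with limitAlike-approx M
    ...   | n , M≤n , approx = n , B' , B'-rainbow
      where
      belowN : Below n (h ∘ₑ eB)
      belowN = below-mono {X = h ∘ₑ eB} M≤n belowM

      B' : Emb B (Seg n)
      B' = restrict (h ∘ₑ eB) belowN

      inB : (e : Emb C (Seg n)) → e ⊆Im B' → unrestrict e ⊆Im (h ∘ₑ eB)
      inB e = unrestrict-⊆ e (h ∘ₑ eB) belowN

      colour-unrestrict : (e : Emb C (Seg n)) → colourAt n (unrestrict e) (unrestrict-below e) ≡ col (γ n) e
      colour-unrestrict e = well-def (γ n) (restrict (unrestrict e) (unrestrict-below e)) e
                                     (restrict-unrestrict e (unrestrict-below e))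

      B'-rainbow : InjectiveOnCopiesIn (γ n) B'
      B'-rainbow e e' e⊆ e'⊆ sameColour = unrestrict-reflects e e' (rainbow X X' X⊆h X'⊆h limitSame)
        where
        X X' : Emb C R
        X  = unrestrict e
        X' = unrestrict e'
        X⊆h : X ⊆Im h
        X⊆h = ⊆-∘ₑ X h eB (inB e e⊆)
        X'⊆h : X' ⊆Im h
        X'⊆h = ⊆-∘ₑ X' h eB (inB e' e'⊆)
        limitSame : col limitColouring X ≡ col limitColouring X'
        limitSame = from (proj₂ classes X X')
          (from (approx X X' (below-⊆ X (h ∘ₑ eB) (inB e e⊆) belowM) (below-⊆ X' (h ∘ₑ eB) (inB e' e'⊆) belowM)
                        (unrestrict-below e) (unrestrict-below e'))
                (trans (colour-unrestrict e) (trans sameColour (sym (colour-unrestrict e')))))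

  RainbowFor : ((A : Structure L) → Colouring A C → Set) → Structure L → Structure L → Set
  RainbowFor Good A B = (γ : Colouring A C) → Good A γ → Σ (Emb B A) (InjectiveOnCopiesIn γ)

  -- Otherwise every Seg n has a bad colouring, and a
  -- rainbow copy for their limit would give a rainbow copy for one of them.
  compactness : (Good : (A : Structure L) → Colouring A C → Set) →
                (∀ γ → (∀ n → Good (Seg n) (γ n)) → Good R (limitColouring γ)) →
                RainbowFor Good R R →
                ∀ B → InAge R B → Σ (Structure L) λ A → InAge R A × RainbowFor Good A B
  compactness Good good-limit rainbowR B (finiteB , eB) with em {∃ λ n → RainbowFor Good (Seg n) B}
  ... | yes (n , rainbowSeg) = Seg n , seg-inAge n , rainbowSeg
  ... | no noRainbowSeg =
    let (n , rainbowSeg) = limit-rainbow γ finiteB eB (proj₁ rainbowLimit) (proj₂ rainbowLimit)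
    in ⊥-elim (proj₂ (proj₂ (bad n)) rainbowSeg)
    where
    bad : ∀ n → ∃ λ γ → Good (Seg n) γ × ¬ Σ (Emb B (Seg n)) (InjectiveOnCopiesIn γ)
    bad n = counterexample λ rainbowSeg → noRainbowSeg (n , rainbowSeg)

    γ : ∀ n → Colouring (Seg n) C
    γ n = proj₁ (bad n)

    rainbowLimit : Σ (Emb R R) (InjectiveOnCopiesIn (limitColouring γ))
    rainbowLimit = rainbowR (limitColouring γ) (good-limit γ (proj₁ ∘ proj₂ ∘ bad))

lemma5p3 : (lem : ∀ {ℓ : Level} → ExcludedMiddle ℓ)
    → {L : Signature} (R C : Structure L) (k : ℕ)
    → IsCountablyInfinite R → IsFinite C
    → ((RainbowDelta k R R C
    → (B : Structure L) → InAge R B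
    → Σ (Structure L) λ A → InAge R A × RainbowDelta k A B C)
    × (RainbowBdd k R R C
    → (B : Structure L) → InAge R B
    → Σ (Structure L) λ A → InAge R A × RainbowBdd k A B C))
lemma5p3 lem R C k enum (c , isoC) =
  compactness (λ _ → KDelta k) (λ γ → limit-kDelta γ) ,
  compactness (λ _ → KBounded k) (λ γ → limit-kBounded γ)
  where open LimitColouring (λ {P} → lem {0ℓ} {P}) R enum C c isoC
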